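{- Let $n$ be an odd positive integer with $n=p_1^{a_1}\cdots p_k^{a_k}$, where $p_1<\cdots<p_k$ are distinct primes and each $a_i\ge1$, and suppose that $\sigma(p_i^{a_i})$ is prime for every $1\le i\le k$. Then $$\frac{\sigma(\sigma(n))}{n}\le \prod_{i=1}^k\left(\frac{p_i}{p_i-1}+\frac{1}{p_i^2}\right).$$
   Context: $\sigma(m)$ denotes the sum of the positive divisors of the positive integer $m$. -}

module Defs where

open import Data.Nat using (ℕ; zero; suc; _∸_)
open import Data.Nat.Divisibility using (_∣?_)
open import Data.List using (List; filter; applyUpTo)
open import Data.Nat.ListAction using (sum)
open import Data.Fin using (Fin)
import Data.Nat as ℕ
open import Data.Integer using (+_)
open import Data.Rational using (ℚ; _/_)
import Data.Rational as ℚ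

σ : ℕ → ℕ
σ m = sum (filter (_∣? m) (applyUpTo suc m))

-- a / b as a rational number; only ever used with b ≠ 0 in the statement
-- (the value at b = 0 is the junk value 0).
frac : ℕ → ℕ → ℚ
frac a zero    = ℚ.0ℚ
frac a (suc b) = (+ a) / suc b

prodℕ : ∀ {k} → (Fin k → ℕ) → ℕ
prodℕ {zero}  f = 1
prodℕ {suc k} f = f Fin.zero ℕ.* prodℕ (λ i → f (Fin.suc i))
  where import Data.Fin as Fin

prodℚ : ∀ {k} → (Fin k → ℚ) → ℚ
prodℚ {zero}  f = ℚ.1ℚ
prodℚ {suc k} f = f Fin.zero ℚ.* prodℚ (λ i → f (Fin.suc i))
  where import Data.Fin as Fin

{-# OPTIONS --safe #-}
module Submission where

-- Multiplicativity of σ gives σ(n) = ∏ qᵢ with qᵢ = σ(pᵢ^aᵢ) prime, and submultiplicativity then gives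
-- σ(σ(n)) ≤ ∏ σ(qᵢ) = ∏ (1 + qᵢ), so it suffices to bound each factor (1 + q)/p^a. For an odd prime p,
-- σ(p) = p + 1 is even, so a ≥ 2; the geometric sum gives (p − 1) q < p^(a+1), whence
-- (1 + q)/p^a ≤ p/(p − 1) + 1/p^a ≤ p/(p − 1) + 1/p².

module DivisorSums where

  open import Defs
  open import Data.Nat using (ℕ; zero; suc; _+_; _*_; _∸_; _^_; _≤_; _<_; z≤n; s≤s; NonZero; nonTrivial⇒n>1; >-nonZero; ≢-nonZero)
  open import Data.Nat.Properties
  open import Data.Nat.Divisibility
  open import Data.Nat.Coprimality using (Coprime; coprime-divisor; coprime-/gcd; 1-coprimeTo) renaming (sym to coprime-sym)
  open import Data.Nat.GCD using (gcd; gcd[m,n]∣m; gcd[m,n]∣n; gcd[m,n]≢0)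
  open import Data.Nat.DivMod using (_/_; m*[n/m]≡n)
  open import Data.Nat.Primality using (Prime; prime⇒irreducible; prime⇒nonTrivial; prime⇒nonZero; ¬prime[0]; ¬prime[1])
  open import Data.Nat.ListAction using (sum)
  open import Data.Nat.ListAction.Properties using (sum-++; sum-↭)
  open import Data.List using (List; []; _∷_; _++_; map; filter; applyUpTo; applyDownFrom; cartesianProductWith)
  open import Data.List.Membership.Propositional using (_∈_)
  open import Data.List.Membership.Propositional.Properties
    using (∈-∃++; ∈-filter⁺; ∈-filter⁻; ∈-applyUpTo⁺; ∈-applyUpTo⁻; ∈-applyDownFrom⁺; ∈-map⁻; ∈-cartesianProductWith⁺; ∈-cartesianProductWith⁻)
  open import Data.List.Relation.Binary.Subset.Propositional using (_⊆_)
  open import Data.List.Relation.Binary.Permutation.Propositional using (↭-sym)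
  open import Data.List.Relation.Binary.Permutation.Propositional.Properties using (shift; ∈-resp-↭)
  open import Data.List.Relation.Unary.Any using (here; there)
  open import Data.List.Relation.Unary.All as All using (All; []; _∷_)
  open import Data.List.Relation.Unary.All.Properties as All using ()
  open import Data.List.Relation.Unary.Unique.Propositional using (Unique; []; _∷_)
  import Data.List.Relation.Unary.Unique.Propositional.Properties as Unique
  open import Data.Fin using (Fin) renaming (zero to fzero; suc to fsuc)
  import Data.Fin as F
  open import Data.Product using (∃; ∃₂; _×_; _,_; proj₁; proj₂)
  open import Data.Sum using (_⊎_; inj₁; inj₂; [_,_]′)
  open import Function using (_∘_)
  open import Relation.Nullary using (¬_; yes; no; contradiction)
  open import Relation.Binary.PropositionalEquality using (_≡_; _≢_; refl; sym; trans; cong; cong₂; subst; subst₂; module ≡-Reasoning)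

  sum-mono-⊆ : ∀ {xs ys : List ℕ} → Unique xs → xs ⊆ ys → sum xs ≤ sum ys
  sum-mono-⊆ {[]} _ _ = z≤n
  sum-mono-⊆ {x ∷ xs} (x∉xs ∷ xs!) xs⊆ys with us , vs , refl ← ∈-∃++ (xs⊆ys (here refl)) =
    begin
      x + sum xs           ≤⟨ +-monoʳ-≤ x (sum-mono-⊆ xs! xs⊆us++vs) ⟩
      x + sum (us ++ vs)   ≡⟨ sum-↭ (↭-sym (shift x us vs)) ⟩
      sum (us ++ x ∷ vs)   ∎
    where
    open ≤-Reasoning
    xs⊆us++vs : xs ⊆ us ++ vs
    xs⊆us++vs z∈xs with ∈-resp-↭ (shift x us vs) (xs⊆ys (there z∈xs))
    ... | here z≡x     = contradiction (sym z≡x) (All.lookup x∉xs z∈xs)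
    ... | there z∈rest = z∈rest

  module _ {A B C : Set} (f : A → B → C) where

    Unique-map-on : ∀ {ys : List B} {x} → Unique ys →
      (∀ {y z} → y ∈ ys → z ∈ ys → f x y ≡ f x z → y ≡ z) → Unique (map (f x) ys)
    Unique-map-on [] _ = []
    Unique-map-on (y∉ys ∷ ys!) inj =
      All.map⁺ (All.tabulate λ z∈ys e → All.lookup y∉ys z∈ys (inj (here refl) (there z∈ys) e))
      ∷ Unique-map-on ys! (λ y∈ z∈ → inj (there y∈) (there z∈))

    Unique-cartesianProductWith-on : ∀ {xs ys} → Unique xs → Unique ys →
      (∀ {w x y z} → w ∈ xs → x ∈ xs → y ∈ ys → z ∈ ys → f w y ≡ f x z → w ≡ x × y ≡ z) →
      Unique (cartesianProductWith f xs ys)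
    Unique-cartesianProductWith-on [] _ _ = []
    Unique-cartesianProductWith-on {x ∷ xs} {ys} (x∉xs ∷ xs!) ys! inj =
      Unique.++⁺ (Unique-map-on ys! λ y∈ z∈ → proj₂ ∘ inj (here refl) (here refl) y∈ z∈)
                 (Unique-cartesianProductWith-on xs! ys! λ w∈ x∈ → inj (there w∈) (there x∈))
                 disjoint
      where
      disjoint : ∀ {v} → ¬ (v ∈ map (f x) ys × v ∈ cartesianProductWith f xs ys)
      disjoint (v∈map , v∈rest)
        with y , y∈ys , refl ← ∈-map⁻ (f x) v∈map
           | x′ , y′ , x′∈xs , y′∈ys , e ← ∈-cartesianProductWith⁻ f xs ys v∈rest
        = All.lookup x∉xs x′∈xs (proj₁ (inj (here refl) (there x′∈xs) y∈ys y′∈ys e))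

  sum-map-*ˡ : ∀ x ys → sum (map (x *_) ys) ≡ x * sum ys
  sum-map-*ˡ x []       = sym (*-zeroʳ x)
  sum-map-*ˡ x (y ∷ ys) = trans (cong ((x * y) +_) (sum-map-*ˡ x ys)) (sym (*-distribˡ-+ x y (sum ys)))

  sum-cartesianProductWith-* : ∀ xs ys → sum (cartesianProductWith _*_ xs ys) ≡ sum xs * sum ys
  sum-cartesianProductWith-* []       ys = refl
  sum-cartesianProductWith-* (x ∷ xs) ys = begin
    sum (map (x *_) ys ++ cartesianProductWith _*_ xs ys)       ≡⟨ sum-++ (map (x *_) ys) _ ⟩
    sum (map (x *_) ys) + sum (cartesianProductWith _*_ xs ys)  ≡⟨ cong₂ _+_ (sum-map-*ˡ x ys) (sum-cartesianProductWith-* xs ys) ⟩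
    x * sum ys + sum xs * sum ys                                ≡⟨ sym (*-distribʳ-+ (sum ys) x (sum xs)) ⟩
    (x + sum xs) * sum ys                                       ∎
    where open ≡-Reasoning

  divisors : ℕ → List ℕ
  divisors m = filter (_∣? m) (applyUpTo suc m)

  divisors-unique : ∀ m → Unique (divisors m)
  divisors-unique m = Unique.filter⁺ (_∣? m) (Unique.applyUpTo⁺₁ suc m λ i<j _ → <⇒≢ i<j ∘ suc-injective)

  ∈-divisors⁻ : ∀ {d} m → d ∈ divisors m → 0 < d × d ∣ m
  ∈-divisors⁻ m d∈ with d∈upTo , d∣m ← ∈-filter⁻ (_∣? m) {xs = applyUpTo suc m} d∈
                  with _ , _ , refl ← ∈-applyUpTo⁻ suc d∈upTo = s≤s z≤n , d∣m

  ∈-divisors⁺ : ∀ {d m} → 0 < m → d ∣ m → d ∈ divisors m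
  ∈-divisors⁺ {zero}  {suc m} _ d∣m with () ← 0∣⇒≡0 d∣m
  ∈-divisors⁺ {suc d} {suc m} _ d∣m = ∈-filter⁺ (_∣? suc m) (∈-applyUpTo⁺ suc (∣⇒≤ d∣m)) d∣m

  coprime-divisors : ∀ {m n d e} → Coprime m n → d ∣ m → e ∣ n → Coprime d e
  coprime-divisors m⊥n d∣m e∣n (c∣d , c∣e) = m⊥n (∣-trans c∣d d∣m , ∣-trans c∣e e∣n)

  -- d = gcd(d, m) · (d / gcd(d, m)), and the second factor is coprime to m / gcd(d, m), so it divides n.
  ∣*-split : ∀ {d m n} → 0 < m → d ∣ m * n → ∃₂ λ d₁ d₂ → d₁ ∣ m × d₂ ∣ n × d ≡ d₁ * d₂
  ∣*-split {d} {m} {n} m>0 d∣mn = g , d / g , gcd[m,n]∣n d m , d/g∣n , sym (m*[n/m]≡n (gcd[m,n]∣m d m))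
    where
    g = gcd d m
    instance
      g≢0 : NonZero g
      g≢0 = ≢-nonZero (gcd[m,n]≢0 d m (inj₂ (>⇒≢ m>0)))
    g*[d/g]∣g*[m/g*n] : g * (d / g) ∣ g * (m / g * n)
    g*[d/g]∣g*[m/g*n] = subst₂ _∣_ (sym (m*[n/m]≡n (gcd[m,n]∣m d m)))
      (trans (cong (_* n) (sym (m*[n/m]≡n (gcd[m,n]∣n d m)))) (*-assoc g (m / g) n)) d∣mn
    d/g∣n : d / g ∣ n
    d/g∣n = coprime-divisor (coprime-/gcd d m) (*-cancelˡ-∣ g g*[d/g]∣g*[m/g*n])

  σ-*-≤ : ∀ m n → σ (m * n) ≤ σ m * σ n
  σ-*-≤ zero n = z≤n
  σ-*-≤ m zero rewrite *-zeroʳ m = z≤n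
  σ-*-≤ m@(suc _) n@(suc _) = begin
    σ (m * n)                                                  ≤⟨ sum-mono-⊆ (divisors-unique (m * n)) divisors-⊆ ⟩
    sum (cartesianProductWith _*_ (divisors m) (divisors n))  ≡⟨ sum-cartesianProductWith-* (divisors m) (divisors n) ⟩
    σ m * σ n                                                  ∎
    where
    open ≤-Reasoning
    m>0 : 0 < m
    m>0 = s≤s z≤n
    n>0 : 0 < n
    n>0 = s≤s z≤n
    divisors-⊆ : divisors (m * n) ⊆ cartesianProductWith _*_ (divisors m) (divisors n)
    divisors-⊆ d∈ with d₁ , d₂ , d₁∣m , d₂∣n , refl ← ∣*-split m>0 (proj₂ (∈-divisors⁻ (m * n) d∈)) =
      ∈-cartesianProductWith⁺ _*_ (∈-divisors⁺ m>0 d₁∣m) (∈-divisors⁺ n>0 d₂∣n)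

  σ-*-coprime : ∀ {m n} → 0 < m → 0 < n → Coprime m n → σ (m * n) ≡ σ m * σ n
  σ-*-coprime {m} {n} m>0 n>0 m⊥n = ≤-antisym (σ-*-≤ m n) (begin
    σ m * σ n                                                  ≡⟨ sym (sum-cartesianProductWith-* (divisors m) (divisors n)) ⟩
    sum (cartesianProductWith _*_ (divisors m) (divisors n))  ≤⟨ sum-mono-⊆ products-unique products-⊆ ⟩
    σ (m * n)                                                  ∎)
    where
    open ≤-Reasoning
    products-⊆ : cartesianProductWith _*_ (divisors m) (divisors n) ⊆ divisors (m * n)
    products-⊆ v∈ with x , y , x∈ , y∈ , refl ← ∈-cartesianProductWith⁻ _*_ (divisors m) (divisors n) v∈ =
      ∈-divisors⁺ (*-mono-≤ m>0 n>0) (*-pres-∣ (proj₂ (∈-divisors⁻ m x∈)) (proj₂ (∈-divisors⁻ n y∈)))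
    -- w ∣ x z with w coprime to z forces w ∣ x, and symmetrically.
    products-injective : ∀ {w x y z} → w ∈ divisors m → x ∈ divisors m → y ∈ divisors n → z ∈ divisors n →
      w * y ≡ x * z → w ≡ x × y ≡ z
    products-injective {w} {x} {y} {z} w∈ x∈ y∈ z∈ wy≡xz =
      w≡x , *-cancelˡ-≡ y z w {{>-nonZero (proj₁ (∈-divisors⁻ m w∈))}} (trans wy≡xz (cong (_* z) (sym w≡x)))
      where
      w⊥z : Coprime w z
      w⊥z = coprime-divisors m⊥n (proj₂ (∈-divisors⁻ m w∈)) (proj₂ (∈-divisors⁻ n z∈))
      x⊥y : Coprime x y
      x⊥y = coprime-divisors m⊥n (proj₂ (∈-divisors⁻ m x∈)) (proj₂ (∈-divisors⁻ n y∈))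
      w≡x : w ≡ x
      w≡x = ∣-antisym
        (coprime-divisor w⊥z (subst (w ∣_) (trans wy≡xz (*-comm x z)) (m∣m*n y)))
        (coprime-divisor x⊥y (subst (x ∣_) (trans (sym wy≡xz) (*-comm w y)) (m∣m*n z)))
    products-unique : Unique (cartesianProductWith _*_ (divisors m) (divisors n))
    products-unique = Unique-cartesianProductWith-on _*_ (divisors-unique m) (divisors-unique n) products-injective

  prime>1 : ∀ {p} → Prime p → 1 < p
  prime>1 {p} p-prime = nonTrivial⇒n>1 p {{prime⇒nonTrivial p-prime}}

  σ-prime : ∀ {q} → Prime q → σ q ≡ 1 + q
  σ-prime {q} q-prime = trans (≤-antisym upper lower) (cong suc (+-identityʳ q))
    where
    q>0 : 0 < q
    q>0 = <-trans (s≤s z≤n) (prime>1 q-prime)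
    upper : σ q ≤ sum (1 ∷ q ∷ [])
    upper = sum-mono-⊆ {ys = 1 ∷ q ∷ []} (divisors-unique q) λ d∈ →
      [ here , there ∘ here ]′ (prime⇒irreducible q-prime (proj₂ (∈-divisors⁻ q d∈)))
    lower : sum (1 ∷ q ∷ []) ≤ σ q
    lower = sum-mono-⊆ ((<⇒≢ (prime>1 q-prime) ∷ []) ∷ [] ∷ []) λ where
      (here refl)         → ∈-divisors⁺ q>0 (1∣ q)
      (there (here refl)) → ∈-divisors⁺ q>0 ∣-refl

  ∣p^a⇒≡p^j : ∀ {p d} → Prime p → ∀ a → d ∣ p ^ a → ∃ λ j → j ≤ a × d ≡ p ^ j
  ∣p^a⇒≡p^j p-prime zero d∣1 = 0 , z≤n , ∣1⇒≡1 d∣1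
  ∣p^a⇒≡p^j {p} {d} p-prime (suc a) d∣p^[1+a] with p ∣? d
  ... | yes (divides d′ refl) =
    let j , j≤a , d′≡p^j = ∣p^a⇒≡p^j p-prime a d′∣p^a
    in suc j , s≤s j≤a , trans (cong (_* p) d′≡p^j) (*-comm (p ^ j) p)
    where
    d′∣p^a : d′ ∣ p ^ a
    d′∣p^a = *-cancelˡ-∣ p {{prime⇒nonZero p-prime}} (subst (_∣ p * p ^ a) (*-comm d′ p) d∣p^[1+a])
  ... | no p∤d =
    let j , j≤a , d≡p^j = ∣p^a⇒≡p^j p-prime a (coprime-divisor d⊥p d∣p^[1+a])
    in j , m≤n⇒m≤1+n j≤a , d≡p^j
    where
    d⊥p : Coprime d p
    d⊥p (c∣d , c∣p) with prime⇒irreducible p-prime c∣p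
    ... | inj₁ c≡1  = c≡1
    ... | inj₂ refl = contradiction c∣d p∤d

  geometric-sum : ∀ r a → 1 + r * sum (applyDownFrom (suc r ^_) a) ≡ suc r ^ a
  geometric-sum r zero    = cong suc (*-zeroʳ r)
  geometric-sum r (suc a) = begin
    1 + r * (x + s)        ≡⟨ cong suc (*-distribˡ-+ r x s) ⟩
    1 + (r * x + r * s)    ≡⟨ sym (+-suc (r * x) (r * s)) ⟩
    r * x + (1 + r * s)    ≡⟨ cong (r * x +_) (geometric-sum r a) ⟩
    r * x + x              ≡⟨ +-comm (r * x) x ⟩
    suc r * x              ∎
    where
    open ≡-Reasoning
    x = suc r ^ a
    s = sum (applyDownFrom (suc r ^_) a)

  σ-prime-power-< : ∀ {p} → Prime p → ∀ a → (p ∸ 1) * σ (p ^ a) < p ^ suc a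
  σ-prime-power-< {zero}  p-prime _ = contradiction p-prime ¬prime[0]
  σ-prime-power-< {suc r} p-prime a = begin-strict
    r * σ (suc r ^ a)                                      <⟨ s≤s (*-monoʳ-≤ r σ≤geometric) ⟩
    1 + r * sum (applyDownFrom (suc r ^_) (suc a))        ≡⟨ geometric-sum r (suc a) ⟩
    suc r ^ suc a                                          ∎
    where
    open ≤-Reasoning
    σ≤geometric : σ (suc r ^ a) ≤ sum (applyDownFrom (suc r ^_) (suc a))
    σ≤geometric = sum-mono-⊆ (divisors-unique (suc r ^ a)) λ d∈ →
      let j , j≤a , d≡p^j = ∣p^a⇒≡p^j p-prime a (proj₂ (∈-divisors⁻ (suc r ^ a) d∈))
      in subst (_∈ applyDownFrom (suc r ^_) (suc a)) (sym d≡p^j) (∈-applyDownFrom⁺ (suc r ^_) (s≤s j≤a))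

  parity : ∀ n → 2 ∣ n ⊎ 2 ∣ suc n
  parity zero    = inj₁ (2 ∣0)
  parity (suc n) = [ inj₂ ∘ ∣m∣n⇒∣m+n (∣-refl {2}) , inj₁ ]′ (parity n)

  ¬prime[1+odd] : ∀ {p} → 1 < p → ¬ 2 ∣ p → ¬ Prime (1 + p)
  ¬prime[1+odd] {p} p>1 2∤p 1+p-prime with parity p
  ... | inj₁ 2∣p   = 2∤p 2∣p
  ... | inj₂ 2∣1+p with prime⇒irreducible 1+p-prime 2∣1+p
  ...   | inj₁ ()
  ...   | inj₂ refl = <-irrefl refl p>1

  coprime-*ʳ : ∀ {m n o} → Coprime m n → Coprime m o → Coprime m (n * o)
  coprime-*ʳ m⊥n m⊥o (d∣m , d∣no) = m⊥o (d∣m , coprime-divisor (coprime-divisors m⊥n d∣m ∣-refl) d∣no)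

  coprime-^ʳ : ∀ {m n} → Coprime m n → ∀ b → Coprime m (n ^ b)
  coprime-^ʳ {m} m⊥n zero    = coprime-sym (1-coprimeTo m)
  coprime-^ʳ     m⊥n (suc b) = coprime-*ʳ m⊥n (coprime-^ʳ m⊥n b)

  coprime-^ : ∀ {m n} → Coprime m n → ∀ a b → Coprime (m ^ a) (n ^ b)
  coprime-^ m⊥n a b = coprime-sym (coprime-^ʳ (coprime-sym (coprime-^ʳ m⊥n b)) a)

  coprime-primes : ∀ {p q} → Prime p → Prime q → p ≢ q → Coprime p q
  coprime-primes p-prime q-prime p≢q (d∣p , d∣q) with prime⇒irreducible p-prime d∣p
  ... | inj₁ d≡1 = d≡1
  ... | inj₂ refl with prime⇒irreducible q-prime d∣q
  ...   | inj₁ refl = contradiction p-prime ¬prime[1]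
  ...   | inj₂ p≡q  = contradiction p≡q p≢q

  m∣m^n : ∀ m {n} → 1 ≤ n → m ∣ m ^ n
  m∣m^n m (s≤s z≤n) = m∣m*n _

  prodℕ-pos : ∀ {k} (f : Fin k → ℕ) → (∀ i → 0 < f i) → 0 < prodℕ f
  prodℕ-pos {zero}  f f>0 = s≤s z≤n
  prodℕ-pos {suc k} f f>0 = *-mono-≤ (f>0 fzero) (prodℕ-pos (f ∘ fsuc) (f>0 ∘ fsuc))

  ∣prodℕ : ∀ {k} (f : Fin k → ℕ) i → f i ∣ prodℕ f
  ∣prodℕ f fzero    = m∣m*n _
  ∣prodℕ f (fsuc i) = ∣n⇒∣m*n (f fzero) (∣prodℕ (f ∘ fsuc) i)

  coprime-prodℕ : ∀ {m k} (f : Fin k → ℕ) → (∀ i → Coprime m (f i)) → Coprime m (prodℕ f)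
  coprime-prodℕ {m} {zero}  f m⊥f = coprime-sym (1-coprimeTo m)
  coprime-prodℕ {k = suc k} f m⊥f = coprime-*ʳ (m⊥f fzero) (coprime-prodℕ (f ∘ fsuc) (m⊥f ∘ fsuc))

  σ-prodℕ-≤ : ∀ {k} (f : Fin k → ℕ) → σ (prodℕ f) ≤ prodℕ (σ ∘ f)
  σ-prodℕ-≤ {zero}  f = ≤-refl
  σ-prodℕ-≤ {suc k} f = ≤-trans (σ-*-≤ (f fzero) _) (*-monoʳ-≤ (σ (f fzero)) (σ-prodℕ-≤ (f ∘ fsuc)))

  σ-prodℕ : ∀ {k} (f : Fin k → ℕ) → (∀ i → 0 < f i) → (∀ i j → i F.< j → Coprime (f i) (f j)) →
    σ (prodℕ f) ≡ prodℕ (σ ∘ f)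
  σ-prodℕ {zero}  f f>0 f-coprime = refl
  σ-prodℕ {suc k} f f>0 f-coprime = begin
    σ (f fzero * prodℕ (f ∘ fsuc))        ≡⟨ σ-*-coprime (f>0 fzero) (prodℕ-pos (f ∘ fsuc) (f>0 ∘ fsuc)) f₀⊥rest ⟩
    σ (f fzero) * σ (prodℕ (f ∘ fsuc))    ≡⟨ cong (σ (f fzero) *_) (σ-prodℕ (f ∘ fsuc) (f>0 ∘ fsuc) rest-coprime) ⟩
    σ (f fzero) * prodℕ (σ ∘ f ∘ fsuc)    ∎
    where
    open ≡-Reasoning
    f₀⊥rest : Coprime (f fzero) (prodℕ (f ∘ fsuc))
    f₀⊥rest = coprime-prodℕ (f ∘ fsuc) λ i → f-coprime fzero (fsuc i) (s≤s z≤n)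
    rest-coprime : ∀ i j → i F.< j → Coprime (f (fsuc i)) (f (fsuc j))
    rest-coprime i j i<j = f-coprime (fsuc i) (fsuc j) (s≤s i<j)

module Ratios where

  open DivisorSums using (prodℕ-pos; prime>1; σ-prime; σ-prime-power-<; ¬prime[1+odd])
  open import Defs
  open import Data.Nat using (ℕ; zero; suc; _+_; _*_; _∸_; _^_; _≤_; _<_; z≤n; s≤s; NonZero)
  import Data.Nat.Properties as ℕ
  open import Data.Nat.Divisibility using (_∣_)
  open import Data.Nat.Primality using (Prime; prime⇒nonZero)
  open import Data.Nat.Tactic.RingSolver using (solve)
  open import Data.Fin using (Fin) renaming (zero to fzero; suc to fsuc)
  open import Data.Integer using (+_)
  import Data.Integer as ℤ
  open import Data.Integer.Properties using (pos-*; pos-+)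
  open import Data.Rational using (ℚ; NonNegative; nonNegative; toℚᵘ)
  import Data.Rational as ℚ
  import Data.Rational.Properties as ℚ
  open import Data.Rational.Unnormalised using (mkℚᵘ; *≤*) renaming (_≃_ to _≃ᵘ_)
  import Data.Rational.Unnormalised.Properties as ℚᵘ
  open import Data.List using ([]; _∷_)
  open import Function using (_∘_)
  open import Relation.Nullary using (¬_; contradiction)
  open import Relation.Binary.PropositionalEquality using (_≡_; refl; sym; trans; cong; cong₂; subst; subst₂)

  toℚᵘ-frac : ∀ a b → toℚᵘ (frac a (suc b)) ≃ᵘ mkℚᵘ (+ a) b
  toℚᵘ-frac a b = ℚ.toℚᵘ-fromℚᵘ (mkℚᵘ (+ a) b)

  toℚᵘ≃⇒≡frac : ∀ {p a b} → toℚᵘ p ≃ᵘ mkℚᵘ (+ a) b → p ≡ frac a (suc b)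
  toℚᵘ≃⇒≡frac {p} {a} {b} p≃ = ℚ.toℚᵘ-injective (ℚᵘ.≃-trans p≃ (ℚᵘ.≃-sym (toℚᵘ-frac a b)))

  frac-≤ : ∀ a b c d → 0 < b → 0 < d → a * d ≤ c * b → frac a b ℚ.≤ frac c d
  frac-≤ a (suc b) c (suc d) _ _ ad≤cb = ℚ.toℚᵘ-cancel-≤
    (ℚᵘ.≤-respʳ-≃ (ℚᵘ.≃-sym (toℚᵘ-frac c d)) (ℚᵘ.≤-respˡ-≃ (ℚᵘ.≃-sym (toℚᵘ-frac a b))
      (*≤* (subst₂ ℤ._≤_ (pos-* a (suc d)) (pos-* c (suc b)) (ℤ.+≤+ ad≤cb)))))

  frac-* : ∀ a b c d → 0 < b → 0 < d → frac a b ℚ.* frac c d ≡ frac (a * c) (b * d)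
  frac-* a (suc b) c (suc d) _ _ = toℚᵘ≃⇒≡frac
    (ℚᵘ.≃-trans (ℚ.toℚᵘ-homo-* (frac a (suc b)) (frac c (suc d)))
    (ℚᵘ.≃-trans (ℚᵘ.*-cong (toℚᵘ-frac a b) (toℚᵘ-frac c d))
                (ℚᵘ.≃-reflexive (cong (λ z → mkℚᵘ z _) (sym (pos-* a c))))))

  frac-+ : ∀ a b c d → 0 < b → 0 < d → frac a b ℚ.+ frac c d ≡ frac (a * d + c * b) (b * d)
  frac-+ a (suc b) c (suc d) _ _ = toℚᵘ≃⇒≡frac
    (ℚᵘ.≃-trans (ℚ.toℚᵘ-homo-+ (frac a (suc b)) (frac c (suc d)))
    (ℚᵘ.≃-trans (ℚᵘ.+-cong (toℚᵘ-frac a b) (toℚᵘ-frac c d))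
                (ℚᵘ.≃-reflexive (cong (λ z → mkℚᵘ z _) numerator))))
    where
    numerator : + a ℤ.* + suc d ℤ.+ + c ℤ.* + suc b ≡ + (a * suc d + c * suc b)
    numerator = sym (trans (pos-+ (a * suc d) (c * suc b)) (cong₂ ℤ._+_ (pos-* a (suc d)) (pos-* c (suc b))))

  frac-nonNeg : ∀ a b → NonNegative (frac a b)
  frac-nonNeg a zero    = _
  frac-nonNeg a (suc b) = ℚ.normalize-nonNeg a (suc b)

  prodℚ-nonNeg : ∀ {k} (f : Fin k → ℚ) → (∀ i → NonNegative (f i)) → NonNegative (prodℚ f)
  prodℚ-nonNeg {zero}  f f≥0 = _
  prodℚ-nonNeg {suc k} f f≥0 =
    ℚ.nonNeg*nonNeg⇒nonNeg (f fzero) {{f≥0 fzero}} _ {{prodℚ-nonNeg (f ∘ fsuc) (f≥0 ∘ fsuc)}}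

  prodℚ-mono-≤ : ∀ {k} (f g : Fin k → ℚ) → (∀ i → NonNegative (f i)) → (∀ i → f i ℚ.≤ g i) →
    prodℚ f ℚ.≤ prodℚ g
  prodℚ-mono-≤ {zero}  f g f≥0 f≤g = ℚ.≤-refl
  prodℚ-mono-≤ {suc k} f g f≥0 f≤g = ℚ.≤-trans
    (ℚ.*-monoʳ-≤-nonNeg (prodℚ (f ∘ fsuc)) {{prodℚ-nonNeg (f ∘ fsuc) (f≥0 ∘ fsuc)}} (f≤g fzero))
    (ℚ.*-monoˡ-≤-nonNeg (g fzero) {{g₀≥0}} (prodℚ-mono-≤ (f ∘ fsuc) (g ∘ fsuc) (f≥0 ∘ fsuc) (f≤g ∘ fsuc)))
    where
    g₀≥0 : NonNegative (g fzero)
    g₀≥0 = nonNegative (ℚ.≤-trans (ℚ.nonNegative⁻¹ (f fzero) {{f≥0 fzero}}) (f≤g fzero))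

  prodℚ-frac : ∀ {k} (x y : Fin k → ℕ) → (∀ i → 0 < y i) →
    prodℚ (λ i → frac (x i) (y i)) ≡ frac (prodℕ x) (prodℕ y)
  prodℚ-frac {zero}  x y y>0 = refl
  prodℚ-frac {suc k} x y y>0 = trans
    (cong (frac (x fzero) (y fzero) ℚ.*_) (prodℚ-frac (x ∘ fsuc) (y ∘ fsuc) (y>0 ∘ fsuc)))
    (frac-* (x fzero) (y fzero) (prodℕ (x ∘ fsuc)) (prodℕ (y ∘ fsuc))
            (y>0 fzero) (prodℕ-pos (y ∘ fsuc) (y>0 ∘ fsuc)))

  [1+q]/X≤p/[p∸1]+1/p² : ∀ {p q X} → 1 < p → (p ∸ 1) * q < p * X → p * p ≤ X →
    frac (1 + q) X ℚ.≤ frac p (p ∸ 1) ℚ.+ frac 1 (p * p)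
  [1+q]/X≤p/[p∸1]+1/p² {p@(suc r@(suc t))} {q} {X} (s≤s (s≤s z≤n)) rq<pX p²≤X =
    ℚ.≤-trans (frac-≤ (1 + q) X (p * (p * p) + 1 * r) (r * (p * p)) X>0 (s≤s z≤n) cross)
              (ℚ.≤-reflexive (sym (frac-+ p r 1 (p * p) (s≤s z≤n) (s≤s z≤n))))
    where
    X>0 : 0 < X
    X>0 = ℕ.<-≤-trans (s≤s z≤n) p²≤X
    cross : (1 + q) * (r * (p * p)) ≤ (p * (p * p) + 1 * r) * X
    cross = begin
      (1 + q) * (r * (p * p))               ≡⟨ solve (q ∷ t ∷ []) ⟩
      (1 + r * q) * (p * p) + t * (p * p)   ≤⟨ ℕ.+-mono-≤ (ℕ.*-monoˡ-≤ (p * p) rq<pX) (ℕ.*-mono-≤ (ℕ.n≤1+n t) p²≤X) ⟩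
      p * X * (p * p) + r * X               ≡⟨ solve (t ∷ X ∷ []) ⟩
      (p * (p * p) + 1 * r) * X             ∎
      where open ℕ.≤-Reasoning

  σσ[pᵃ]/pᵃ≤p/[p∸1]+1/p² : ∀ {p a} → Prime p → ¬ 2 ∣ p → 1 ≤ a → Prime (σ (p ^ a)) →
    frac (σ (σ (p ^ a))) (p ^ a) ℚ.≤ frac p (p ∸ 1) ℚ.+ frac 1 (p * p)
  σσ[pᵃ]/pᵃ≤p/[p∸1]+1/p² {p} {1} p-prime 2∤p _ σ[p¹]-prime =
    contradiction (subst Prime (trans (cong σ (ℕ.^-identityʳ p)) (σ-prime p-prime)) σ[p¹]-prime)
                  (¬prime[1+odd] (prime>1 p-prime) 2∤p)
  σσ[pᵃ]/pᵃ≤p/[p∸1]+1/p² {p} {a@(suc (suc b))} p-prime _ _ σ[pᵃ]-prime =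
    subst (λ m → frac m (p ^ a) ℚ.≤ _) (sym (σ-prime σ[pᵃ]-prime))
      ([1+q]/X≤p/[p∸1]+1/p² (prime>1 p-prime) (σ-prime-power-< p-prime a) p²≤pᵃ)
    where
    instance
      p≢0 : NonZero p
      p≢0 = prime⇒nonZero p-prime
    p²≤pᵃ : p * p ≤ p ^ a
    p²≤pᵃ = ℕ.*-monoʳ-≤ p (ℕ.m≤m*n p (p ^ b) {{ℕ.m^n≢0 p b}})

open DivisorSums using (m∣m^n; ∣prodℕ; σ-prodℕ; σ-prodℕ-≤; coprime-^; coprime-primes)
open Ratios using (frac-≤; frac-nonNeg; prodℚ-mono-≤; prodℚ-frac; σσ[pᵃ]/pᵃ≤p/[p∸1]+1/p²)
open import Defs
open import Data.Nat using (ℕ; _∸_; _*_; _^_; _≤_; _<_)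
open import Data.Nat.Properties using (<⇒≢; m^n>0; *-monoˡ-≤)
open import Data.Nat.Divisibility using (_∣_; ∣-trans)
open import Data.Nat.Coprimality using (Coprime)
open import Data.Nat.Primality using (Prime; prime⇒nonZero)
open import Data.Fin using (Fin)
import Data.Fin as F
open import Data.Rational using (ℚ; _+_)
import Data.Rational as ℚ
import Data.Rational.Properties as ℚ
open import Function using (_∘_)
open import Relation.Nullary using (¬_)
open import Relation.Binary.PropositionalEquality using (_≡_; refl; sym; subst)

mainTheorem2 : (n k : ℕ) (p a : Fin k → ℕ) →
    1 ≤ n → ¬ (2 ∣ n) →
    (∀ i → Prime (p i)) →
    (∀ i j → F._<_ i j → p i < p j) →
    (∀ i → 1 ≤ a i) →
    n ≡ prodℕ (λ i → p i ^ a i) →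
    (∀ i → Prime (σ (p i ^ a i))) →
    frac (σ (σ n)) n ℚ.≤ prodℚ (λ i → frac (p i) (p i ∸ 1) + frac 1 (p i * p i))
mainTheorem2 n k p a n>0 2∤n p-prime p-increasing a>0 refl σ[pᵃ]-prime = begin
  frac (σ (σ n)) n                                 ≤⟨ frac-≤ _ n _ n n>0 n>0 (*-monoˡ-≤ n σσn≤) ⟩
  frac (prodℕ (σ ∘ σ ∘ P)) n                       ≡⟨ sym (prodℚ-frac (σ ∘ σ ∘ P) P P>0) ⟩
  prodℚ (λ i → frac (σ (σ (P i))) (P i))           ≤⟨ prodℚ-mono-≤ _ _ (λ i → frac-nonNeg _ (P i)) factor-≤ ⟩
  prodℚ (λ i → frac (p i) (p i ∸ 1) + frac 1 (p i * p i)) ∎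
  where
  open ℚ.≤-Reasoning
  P : Fin k → ℕ
  P i = p i ^ a i
  P>0 : ∀ i → 0 < P i
  P>0 i = m^n>0 (p i) {{prime⇒nonZero (p-prime i)}} (a i)
  P-coprime : ∀ i j → i F.< j → Coprime (P i) (P j)
  P-coprime i j i<j =
    coprime-^ (coprime-primes (p-prime i) (p-prime j) (<⇒≢ (p-increasing i j i<j))) (a i) (a j)
  σσn≤ : σ (σ n) ≤ prodℕ (σ ∘ σ ∘ P)
  σσn≤ = subst (λ m → σ m ≤ prodℕ (σ ∘ σ ∘ P)) (sym (σ-prodℕ P P>0 P-coprime)) (σ-prodℕ-≤ (σ ∘ P))
  p-odd : ∀ i → ¬ 2 ∣ p i
  p-odd i 2∣p = 2∤n (∣-trans 2∣p (∣-trans (m∣m^n (p i) (a>0 i)) (∣prodℕ P i)))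
  factor-≤ : ∀ i → frac (σ (σ (P i))) (P i) ℚ.≤ frac (p i) (p i ∸ 1) + frac 1 (p i * p i)
  factor-≤ i = σσ[pᵃ]/pᵃ≤p/[p∸1]+1/p² (p-prime i) (p-odd i) (a>0 i) (σ[pᵃ]-prime i)
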